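{- For all integers $n,k\ge 0$, \[ \sum_{\ell=0}^n\genfrac{[}{]}{0pt}{}{n+1}{\ell+1}C_\ell^k(x)=n!\sum_{j=0}^{\min(n,k)}(x+1)^{\overline{j}}\genfrac{\{}{\}}{0pt}{}{k+1}{j+1}\binom{n+1}{j+1}. \]
   Context: $\genfrac{[}{]}{0pt}{}{m}{j}$ and $\genfrac{\{}{\}}{0pt}{}{m}{j}$ are the unsigned Stirling numbers of the first kind and the Stirling numbers of the second kind; $x^{\overline{j}}=x(x+1)\cdots(x+j-1)$. Callan polynomials: for $n,k\ge0$ let $N=\{1,\dots,n\}\cup\{*\}$, $K=\{1,\dots,k\}\cup\{*'\}$. A Callan sequence of size $n\times k$ consists of $r\ge0$, a set partition of $N$ into nonempty blocks $R_1,\dots,R_r,R^*$ with $*\in R^*$ and of $K$ into nonempty blocks $B_1,\dots,B_r,B^*$ with $*'\in B^*$, arranged as the ordered list of ordinary pairs $(B_1;R_1)\cdots(B_r;R_r)$ (order matters) plus the extra pair $(B^*;R^*)$. A barred Callan sequence additionally has one bar in one of the $r+1$ gaps before, between, or after the ordinary pairs; $\mathrm{BC}_n^k$ is their set. For a word of distinct letters from a totally ordered set let $w$ be its number of left-to-right minima minus one. For $\alpha\in\mathrm{BC}_n^k$, list from left to right the blue blocks $B_1,\dots,B_r$ and the bar as they appear (extra pair ignored), with the bar smaller than every blue block and blue blocks compared by least elements; $w(\alpha)$ is $w$ of this word. $C_n^k(x)=\sum_{\alpha\in\mathrm{BC}_n^k}x^{w(\alpha)}$ for $n,k>0$, and $C_n^0(x)=C_0^k(x)=1$.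 -}

module Defs where

open import Data.Nat using (ℕ; zero; suc; _+_; _*_; _∸_; _<ᵇ_; _⊓_)
open import Data.Bool using (Bool; true; false; if_then_else_)
open import Data.Fin using (Fin; toℕ; _≟_) renaming (zero to fz; suc to fs)
open import Data.Vec using (Vec; []; _∷_; toList)
open import Data.List using (List; []; _∷_; [_]; map; concatMap; allFin; upTo; filterᵇ; take; drop; _++_; foldr)
open import Data.Bool.ListAction using (all; any)
open import Data.Product using (Σ; _×_; _,_)
open import Relation.Nullary.Decidable using (⌊_⌋)
open import Algebra.Bundles using (CommutativeSemiring)

stirling1 : ℕ → ℕ → ℕ
stirling1 zero    zero    = 1
stirling1 zero    (suc k) = 0
stirling1 (suc n) zero    = 0
stirling1 (suc n) (suc k) = n * stirling1 n (suc k) + stirling1 n k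

stirling2 : ℕ → ℕ → ℕ
stirling2 zero    zero    = 1
stirling2 zero    (suc k) = 0
stirling2 (suc n) zero    = 0
stirling2 (suc n) (suc k) = suc k * stirling2 n (suc k) + stirling2 n k

-- Encoding: a sequence with r ordinary pairs is (r , red , blue , bar) where
--   red  : Vec (Fin (suc r)) n  sends red element i+1 to its block:
--          fz = the extra block R* (which also contains *), fs j = R_{j+1};
--   blue : Vec (Fin (suc r)) k  likewise for blue elements (fz = B*, fs j = B_{j+1});
--   bar  : Fin (suc r)          the bar sits after the first (toℕ bar) ordinary pairs.
-- Nonemptiness of R_1..R_r, B_1..B_r is "every fs j is hit".

allVecs : (n m : ℕ) → List (Vec (Fin m) n)
allVecs zero    m = [ [] ]
allVecs (suc n) m = concatMap (λ v → map (λ a → a ∷ v) (allFin m)) (allVecs n m)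

hitsOrdinary : {n : ℕ} (r : ℕ) → Vec (Fin (suc r)) n → Bool
hitsOrdinary r v = all (λ j → any (λ a → ⌊ a ≟ fs j ⌋) (toList v)) (allFin r)

Seq : ℕ → ℕ → Set
Seq n k = Σ ℕ λ r → Vec (Fin (suc r)) n × Vec (Fin (suc r)) k × Fin (suc r)

-- the list of all barred Callan sequences of size n × k (r ≤ n necessarily)
BC : (n k : ℕ) → List (Seq n k)
BC n k = concatMap forR (upTo (suc n))
  where
  forR : ℕ → List (Seq n k)
  forR r =
    concatMap (λ red →
      concatMap (λ blue →
        map (λ b → (r , red , blue , b)) (allFin (suc r)))
        (filterᵇ (hitsOrdinary r) (allVecs k (suc r))))
      (filterᵇ (hitsOrdinary r) (allVecs n (suc r)))

-- index (0-based) of the first occurrence of a in v, i.e. (least element of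
-- the block labelled a) − 1
firstIdx : {m k : ℕ} → Vec (Fin m) k → Fin m → ℕ
firstIdx []       a = 0
firstIdx (y ∷ ys) a = if ⌊ y ≟ a ⌋ then 0 else suc (firstIdx ys a)

ltrMinima : List ℕ → ℕ
ltrMinima []       = 0
ltrMinima (a ∷ as) = suc (go a as)
  where
  go : ℕ → List ℕ → ℕ
  go m []       = 0
  go m (b ∷ bs) = if b <ᵇ m then suc (go b bs) else go m bs

-- the word of blue blocks and bar: bar is letter 0, block B_{j+1} is letter
-- 1 + (its least element − 1) = its least element, so bar < every block and
-- blocks are compared by least elements
word : {n k : ℕ} → Seq n k → List ℕ
word (r , red , blue , b) =
  take (toℕ b) blocks ++ 0 ∷ drop (toℕ b) blocks
  where
  blocks : List ℕ
  blocks = map (λ j → suc (firstIdx blue (fs j))) (allFin r)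

wstat : {n k : ℕ} → Seq n k → ℕ
wstat α = ltrMinima (word α) ∸ 1

-- Polynomial expressions, evaluated at an arbitrary element x of an
-- arbitrary commutative semiring (an identity for all such x is exactly an
-- identity in ℕ[x], taking R = ℕ[x] and x = the indeterminate).

module Eval {c ℓ} (R : CommutativeSemiring c ℓ) where
  open CommutativeSemiring R renaming (_+_ to _+R_; _*_ to _*R_)
  open import Algebra.Definitions.RawSemiring rawSemiring using (_^_) renaming (_×_ to _·_)

  sumTo : ℕ → (ℕ → Carrier) → Carrier
  sumTo zero    f = f 0
  sumTo (suc m) f = sumTo m f +R f (suc m)

  rising : Carrier → ℕ → Carrier
  rising y zero    = 1#
  rising y (suc j) = rising y j *R (y +R (j · 1#))

  callan : Carrier → ℕ → ℕ → Carrier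
  callan x zero    k       = 1#
  callan x (suc n) zero    = 1#
  callan x (suc n) (suc k) =
    foldr (λ α acc → (x ^ wstat α) +R acc) 0# (BC (suc n) (suc k))

-- Group the barred Callan sequences by their number r of ordinary pairs.  The red blocks are an ordered set
-- partition, counted by r! S(l+1, r+1) independently of the rest.  On the blue side, remove the largest blue
-- element: either it lies in one of the r + 1 blocks present before, changing nothing, or it forms a new ordinary
-- block whose least element exceeds all others; inserting such a maximal letter at each of the r + 1 places of
-- the word multiplies the polynomial of the bar positions by x + 1 + r.  So the blue blocks and the bar contribute
-- S(k+1, r+1) (x+1)^(r̄), i.e. C_l^k(x) = Σ_r r! S(l+1, r+1) S(k+1, r+1) (x+1)^(r̄).  Finally,
-- Σ_l [n+1, l+1] S(l+1, r+1) is the Lah number L(n+1, r+1) = n! C(n+1, r+1) / r!, which follows from the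
-- recurrences of the two kinds of Stirling numbers.

module Submission where

open import Defs
open import Data.Nat as ℕ using (ℕ; zero; suc; _!; _⊓_; _≤_; _<_; _<ᵇ_; z≤n; s≤s)
import Data.Nat.Properties as ℕₚ
import Data.Fin.Properties as Finₚ
open import Data.Nat.Combinatorics using (_C_; nCk+nC[k+1]≡[n+1]C[k+1])
open import Data.Nat.Solver using (module +-*-Solver)
open import Data.Bool using (Bool; true; false; if_then_else_; _∧_; _∨_; not)
open import Data.Bool.Properties using (∨-identityʳ; ∨-zeroʳ; ∨-assoc; ∧-zeroʳ)
open import Data.Bool.ListAction using (all; any)
open import Data.Fin using (Fin; toℕ; _≟_; punchIn) renaming (zero to fz; suc to fs)
open import Data.List using (List; []; _∷_; _++_; map; concat; concatMap; tabulate; allFin; filterᵇ; foldr; applyUpTo; upTo; take; drop)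
open import Data.List.Properties using (map-tabulate; take-map)
open import Data.Product using (_,_)
open import Data.Vec as Vec using (Vec; []; _∷_; _∷ʳ_)
open import Data.Vec.Functional using (Vector; insertAt)
open import Data.Sum using (inj₁; inj₂)
open import Function using (_∘_)
open import Relation.Nullary.Decidable using (⌊_⌋; does; yes; no; dec-true; dec-false; isYes≗does)
open import Data.Empty using (⊥-elim)
open import Relation.Binary.PropositionalEquality as ≡ using (_≡_)
open import Algebra.Bundles using (CommutativeSemiring)

module Sums {c ℓ} (R : CommutativeSemiring c ℓ) where

  open CommutativeSemiring R hiding (zero)
  open import Algebra.Definitions.RawSemiring rawSemiring using (_×_)
  open import Algebra.Properties.Semiring.Sum semiring using (sum; sum-replicate-zero; ∑-distrib-+)
  open import Algebra.Properties.Semiring.Mult semiring using (×-congʳ; ×-homo-+; ×-assoc-*)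
  open import Algebra.Properties.CommutativeMonoid.Mult +-commutativeMonoid using (×-distrib-+)
  open import Algebra.Properties.CommutativeSemigroup +-commutativeSemigroup using (interchange)
  open import Relation.Binary.Reasoning.Setoid setoid
  open Eval R public using (sumTo)

  ×-as-* : ∀ n y → n × y ≈ (n × 1#) * y
  ×-as-* n y = sym (trans (×-assoc-* n 1# y) (×-congʳ n (*-identityˡ y)))

  sumTo-cong : ∀ m {f g : ℕ → Carrier} → (∀ i → i ≤ m → f i ≈ g i) → sumTo m f ≈ sumTo m g
  sumTo-cong zero    f≈g = f≈g 0 z≤n
  sumTo-cong (suc m) f≈g = +-cong (sumTo-cong m (λ i i≤m → f≈g i (ℕₚ.m≤n⇒m≤1+n i≤m))) (f≈g (suc m) ℕₚ.≤-refl)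

  sumTo-distrib-+ : ∀ m (f g : ℕ → Carrier) → sumTo m (λ i → f i + g i) ≈ sumTo m f + sumTo m g
  sumTo-distrib-+ zero    f g = refl
  sumTo-distrib-+ (suc m) f g = trans (+-congʳ (sumTo-distrib-+ m f g)) (interchange _ _ _ _)

  *-distribˡ-sumTo : ∀ m a (f : ℕ → Carrier) → a * sumTo m f ≈ sumTo m (λ i → a * f i)
  *-distribˡ-sumTo zero    a f = refl
  *-distribˡ-sumTo (suc m) a f = trans (distribˡ a _ _) (+-congʳ (*-distribˡ-sumTo m a f))

  sumTo-comm : ∀ m n (f : ℕ → ℕ → Carrier) →
    sumTo m (λ i → sumTo n (f i)) ≈ sumTo n (λ j → sumTo m (λ i → f i j))
  sumTo-comm zero    n f = refl
  sumTo-comm (suc m) n f = trans (+-congʳ (sumTo-comm m n f))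
    (sym (sumTo-distrib-+ n (λ j → sumTo m (λ i → f i j)) (f (suc m))))

  sumTo-zero : ∀ m (f : ℕ → Carrier) → (∀ i → f i ≈ 0#) → sumTo m f ≈ 0#
  sumTo-zero zero    f f≈0 = f≈0 0
  sumTo-zero (suc m) f f≈0 = trans (+-cong (sumTo-zero m f f≈0) (f≈0 (suc m))) (+-identityʳ 0#)

  sumTo-truncate : ∀ l m (f : ℕ → Carrier) → l ≤ m → (∀ i → l < i → i ≤ m → f i ≈ 0#) →
    sumTo m f ≈ sumTo l f
  sumTo-truncate l zero    f z≤n  _   = refl
  sumTo-truncate l (suc m) f l≤1+m f≈0 with ℕₚ.m≤n⇒m<n∨m≡n l≤1+m
  ... | inj₂ ≡.refl = refl
  ... | inj₁ l<1+m = trans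
    (+-cong (sumTo-truncate l m f (ℕₚ.<⇒≤pred l<1+m) (λ i l<i i≤m → f≈0 i l<i (ℕₚ.m≤n⇒m≤1+n i≤m)))
            (f≈0 (suc m) l<1+m ℕₚ.≤-refl))
    (+-identityʳ _)

  sumTo-suc : ∀ m (f : ℕ → Carrier) → sumTo (suc m) f ≈ f 0 + sumTo m (f ∘ suc)
  sumTo-suc zero    f = refl
  sumTo-suc (suc m) f = trans (+-congʳ (sumTo-suc m f)) (+-assoc _ _ _)

  sumTo-× : ∀ m (a : ℕ → ℕ) y → Eval.sumTo ℕₚ.+-*-commutativeSemiring m a × y ≈ sumTo m (λ i → a i × y)
  sumTo-× zero    a y = refl
  sumTo-× (suc m) a y =
    trans (×-homo-+ y (Eval.sumTo ℕₚ.+-*-commutativeSemiring m a) (a (suc m))) (+-congʳ (sumTo-× m a y))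

  ×-distrib-sumTo : ∀ m n (f : ℕ → Carrier) → n × sumTo m f ≈ sumTo m (λ i → n × f i)
  ×-distrib-sumTo zero    n f = refl
  ×-distrib-sumTo (suc m) n f = trans (×-distrib-+ (sumTo m f) (f (suc m)) n) (+-congʳ (×-distrib-sumTo m n f))

  listSum : {A : Set} → (A → Carrier) → List A → Carrier
  listSum f = foldr (λ a acc → f a + acc) 0#

  private variable A B : Set

  listSum-cong : {f g : A → Carrier} → (∀ a → f a ≈ g a) → ∀ xs → listSum f xs ≈ listSum g xs
  listSum-cong f≈g []       = refl
  listSum-cong f≈g (x ∷ xs) = +-cong (f≈g x) (listSum-cong f≈g xs)

  listSum-++ : ∀ (f : A → Carrier) xs ys → listSum f (xs ++ ys) ≈ listSum f xs + listSum f ys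
  listSum-++ f []       ys = sym (+-identityˡ _)
  listSum-++ f (x ∷ xs) ys = trans (+-congˡ (listSum-++ f xs ys)) (sym (+-assoc _ _ _))

  listSum-map : ∀ (f : B → Carrier) (g : A → B) xs → listSum f (map g xs) ≡ listSum (f ∘ g) xs
  listSum-map f g []       = ≡.refl
  listSum-map f g (x ∷ xs) = ≡.cong (f (g x) +_) (listSum-map f g xs)

  listSum-concatMap : ∀ (f : B → Carrier) (g : A → List B) xs →
    listSum f (concatMap g xs) ≈ listSum (listSum f ∘ g) xs
  listSum-concatMap f g []       = refl
  listSum-concatMap f g (x ∷ xs) =
    trans (listSum-++ f (g x) (concat (map g xs))) (+-congˡ (listSum-concatMap f g xs))

  listSum-filterᵇ : ∀ (f : A → Carrier) (p : A → Bool) xs →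
    listSum f (filterᵇ p xs) ≈ listSum (λ a → if p a then f a else 0#) xs
  listSum-filterᵇ f p []       = refl
  listSum-filterᵇ f p (x ∷ xs) with p x
  ... | true  = +-congˡ (listSum-filterᵇ f p xs)
  ... | false = trans (listSum-filterᵇ f p xs) (sym (+-identityˡ _))

  listSum-distrib-+ : ∀ (f g : A → Carrier) xs → listSum (λ a → f a + g a) xs ≈ listSum f xs + listSum g xs
  listSum-distrib-+ f g []       = sym (+-identityˡ 0#)
  listSum-distrib-+ f g (x ∷ xs) = trans (+-congˡ (listSum-distrib-+ f g xs)) (interchange _ _ _ _)

  *-distribˡ-listSum : ∀ a (f : A → Carrier) xs → a * listSum f xs ≈ listSum (λ y → a * f y) xs
  *-distribˡ-listSum a f []       = zeroʳ a
  *-distribˡ-listSum a f (x ∷ xs) = trans (distribˡ a _ _) (+-congˡ (*-distribˡ-listSum a f xs))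

  *-distribʳ-listSum : ∀ a (f : A → Carrier) xs → listSum f xs * a ≈ listSum (λ y → f y * a) xs
  *-distribʳ-listSum a f []       = zeroˡ a
  *-distribʳ-listSum a f (x ∷ xs) = trans (distribʳ a _ _) (+-congˡ (*-distribʳ-listSum a f xs))

  listSum-sum-comm : ∀ r (f : A → Fin r → Carrier) xs →
    listSum (λ a → sum (f a)) xs ≈ sum (λ i → listSum (λ a → f a i) xs)
  listSum-sum-comm r f []       = sym (sum-replicate-zero r)
  listSum-sum-comm r f (x ∷ xs) =
    trans (+-congˡ (listSum-sum-comm r f xs)) (sym (∑-distrib-+ (f x) (λ i → listSum (λ a → f a i) xs)))

  listSum-tabulate : ∀ (f : A → Carrier) {r} (g : Fin r → A) → listSum f (tabulate g) ≡ sum (f ∘ g)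
  listSum-tabulate f {zero}  g = ≡.refl
  listSum-tabulate f {suc r} g = ≡.cong (f (g fz) +_) (listSum-tabulate f (g ∘ fs))

  listSum-applyUpTo : ∀ n (g : ℕ → ℕ) (f : ℕ → Carrier) → listSum f (applyUpTo g (suc n)) ≈ sumTo n (f ∘ g)
  listSum-applyUpTo zero    g f = +-identityʳ _
  listSum-applyUpTo (suc n) g f = trans (+-congˡ (listSum-applyUpTo n (g ∘ suc) f)) (sym (sumTo-suc n (f ∘ g)))

-- Stirling and Lah numbers

stirling1-vanishes : ∀ n k → n < k → stirling1 n k ≡ 0
stirling1-vanishes zero    (suc k) _         = ≡.refl
stirling1-vanishes (suc n) (suc k) (s≤s n<k) = ≡.cong₂ ℕ._+_
  (≡.trans (≡.cong (n ℕ.*_) (stirling1-vanishes n (suc k) (ℕₚ.m≤n⇒m≤1+n n<k))) (ℕₚ.*-zeroʳ n))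
  (stirling1-vanishes n k n<k)

stirling2-vanishes : ∀ n k → n < k → stirling2 n k ≡ 0
stirling2-vanishes zero    (suc k) _         = ≡.refl
stirling2-vanishes (suc n) (suc k) (s≤s n<k) = ≡.cong₂ ℕ._+_
  (≡.trans (≡.cong (suc k ℕ.*_) (stirling2-vanishes n (suc k) (ℕₚ.m≤n⇒m≤1+n n<k))) (ℕₚ.*-zeroʳ (suc k)))
  (stirling2-vanishes n k n<k)

stirling2-1 : ∀ n → stirling2 (suc n) 1 ≡ 1
stirling2-1 zero    = ≡.refl
stirling2-1 (suc n) = ≡.trans (ℕₚ.+-identityʳ _) (≡.trans (ℕₚ.+-identityʳ _) (stirling2-1 n))

module ℕΣ = Sums ℕₚ.+-*-commutativeSemiring

module Lah where

  open +-*-Solver using (solve; _:+_; _:*_; _:=_; con)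
  open import Algebra.Properties.CommutativeSemigroup ℕₚ.*-commutativeSemigroup using (x∙yz≈y∙xz)

  pascal : ∀ m k → suc m C suc k ≡ m C k ℕ.+ m C suc k
  pascal m k = ≡.sym (nCk+nC[k+1]≡[n+1]C[k+1] m k)

  binomial-step : ∀ m r → suc r ℕ.* (m C suc r) ℕ.+ r ℕ.* (m C r) ≡ m ℕ.* (m C r)
  binomial-step zero    zero    = ≡.refl
  binomial-step zero    (suc r) = ≡.cong₂ ℕ._+_ (ℕₚ.*-zeroʳ (2 ℕ.+ r)) (ℕₚ.*-zeroʳ (suc r))
  binomial-step (suc m) zero    = begin
    1 ℕ.* (suc m C 1) ℕ.+ 0      ≡⟨ ≡.cong (λ b → 1 ℕ.* b ℕ.+ 0) (pascal m 0) ⟩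
    1 ℕ.* (1 ℕ.+ m C 1) ℕ.+ 0    ≡⟨ solve 1 (λ b → con 1 :* (con 1 :+ b) :+ con 0
                                              := con 1 :+ (con 1 :* b :+ con 0 :* con 1)) ≡.refl (m C 1) ⟩
    1 ℕ.+ (1 ℕ.* (m C 1) ℕ.+ 0 ℕ.* 1) ≡⟨ ≡.cong (1 ℕ.+_) (binomial-step m 0) ⟩
    1 ℕ.+ m ℕ.* 1                ∎
    where open ≡.≡-Reasoning
  binomial-step (suc m) (suc r) = begin
    (2 ℕ.+ r) ℕ.* (suc m C (2 ℕ.+ r)) ℕ.+ (1 ℕ.+ r) ℕ.* (suc m C suc r)
      ≡⟨ ≡.cong₂ (λ c d → (2 ℕ.+ r) ℕ.* c ℕ.+ (1 ℕ.+ r) ℕ.* d) (pascal m (suc r)) (pascal m r) ⟩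
    (2 ℕ.+ r) ℕ.* (b₁ ℕ.+ b₂) ℕ.+ (1 ℕ.+ r) ℕ.* (b₀ ℕ.+ b₁)
      ≡⟨ solve 4 (λ r b₀ b₁ b₂ → (con 2 :+ r) :* (b₁ :+ b₂) :+ (con 1 :+ r) :* (b₀ :+ b₁)
                           := ((con 2 :+ r) :* b₂ :+ (con 1 :+ r) :* b₁) :+ ((con 1 :+ r) :* b₁ :+ r :* b₀) :+ b₁ :+ b₀)
                 ≡.refl r b₀ b₁ b₂ ⟩
    ((2 ℕ.+ r) ℕ.* b₂ ℕ.+ (1 ℕ.+ r) ℕ.* b₁) ℕ.+ ((1 ℕ.+ r) ℕ.* b₁ ℕ.+ r ℕ.* b₀) ℕ.+ b₁ ℕ.+ b₀
      ≡⟨ ≡.cong₂ (λ c d → c ℕ.+ d ℕ.+ b₁ ℕ.+ b₀) (binomial-step m (suc r)) (binomial-step m r) ⟩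
    m ℕ.* b₁ ℕ.+ m ℕ.* b₀ ℕ.+ b₁ ℕ.+ b₀
      ≡⟨ solve 3 (λ m b₀ b₁ → m :* b₁ :+ m :* b₀ :+ b₁ :+ b₀ := (con 1 :+ m) :* (b₀ :+ b₁)) ≡.refl m b₀ b₁ ⟩
    (1 ℕ.+ m) ℕ.* (b₀ ℕ.+ b₁) ≡⟨ ≡.cong ((1 ℕ.+ m) ℕ.*_) (pascal m r) ⟨
    (1 ℕ.+ m) ℕ.* (suc m C suc r) ∎
    where
    open ≡.≡-Reasoning
    b₀ b₁ b₂ : ℕ
    b₀ = m C r
    b₁ = m C suc r
    b₂ = m C suc (suc r)

  -- lah n (suc r) is the unsigned Lah number L(n+1, r+1).
  lah : ℕ → ℕ → ℕ
  lah n j = ℕΣ.sumTo n (λ l → stirling1 (suc n) (suc l) ℕ.* stirling2 (suc l) j)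

  lah-zero : ∀ n → lah n 0 ≡ 0
  lah-zero n = ℕΣ.sumTo-zero n _ (λ l → ℕₚ.*-zeroʳ (stirling1 (suc n) (suc l)))

  lah-suc : ∀ n r → lah (suc n) (suc r) ≡ (suc n ℕ.+ suc r) ℕ.* lah n (suc r) ℕ.+ lah n r
  lah-suc n r = begin
    lah (suc n) (suc r)
      ≡⟨ ℕΣ.sumTo-cong (suc n) (λ l _ → ℕₚ.*-distribʳ-+ (S₂ l) (suc n ℕ.* s₁ (suc l)) (s₁ l)) ⟩
    ℕΣ.sumTo (suc n) (λ l → suc n ℕ.* s₁ (suc l) ℕ.* S₂ l ℕ.+ s₁ l ℕ.* S₂ l)
      ≡⟨ ℕΣ.sumTo-distrib-+ (suc n) _ _ ⟩
    ℕΣ.sumTo (suc n) (λ l → suc n ℕ.* s₁ (suc l) ℕ.* S₂ l) ℕ.+ ℕΣ.sumTo (suc n) (λ l → s₁ l ℕ.* S₂ l)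
      ≡⟨ ≡.cong₂ ℕ._+_ scaled-sum shifted-sum ⟩
    suc n ℕ.* lah n (suc r) ℕ.+ (suc r ℕ.* lah n (suc r) ℕ.+ lah n r)
      ≡⟨ solve 4 (λ n r a b → (con 1 :+ n) :* a :+ ((con 1 :+ r) :* a :+ b) := (con 1 :+ n :+ (con 1 :+ r)) :* a :+ b)
                 ≡.refl n r (lah n (suc r)) (lah n r) ⟩
    (suc n ℕ.+ suc r) ℕ.* lah n (suc r) ℕ.+ lah n r ∎
    where
    open ≡.≡-Reasoning
    s₁ : ℕ → ℕ
    s₁ = stirling1 (suc n)
    S₂ : ℕ → ℕ
    S₂ l = stirling2 (suc l) (suc r)
    scaled-sum : ℕΣ.sumTo (suc n) (λ l → suc n ℕ.* s₁ (suc l) ℕ.* S₂ l) ≡ suc n ℕ.* lah n (suc r)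
    scaled-sum = begin
      ℕΣ.sumTo (suc n) (λ l → suc n ℕ.* s₁ (suc l) ℕ.* S₂ l)
        ≡⟨ ℕΣ.sumTo-truncate n (suc n) _ (ℕₚ.n≤1+n n) (λ i n<i _ → out-of-range i n<i) ⟩
      ℕΣ.sumTo n (λ l → suc n ℕ.* s₁ (suc l) ℕ.* S₂ l)
        ≡⟨ ℕΣ.sumTo-cong n (λ l _ → ℕₚ.*-assoc (suc n) (s₁ (suc l)) (S₂ l)) ⟩
      ℕΣ.sumTo n (λ l → suc n ℕ.* (s₁ (suc l) ℕ.* S₂ l))
        ≡⟨ ℕΣ.*-distribˡ-sumTo n (suc n) _ ⟨
      suc n ℕ.* lah n (suc r) ∎
      where
      out-of-range : ∀ i → n < i → suc n ℕ.* s₁ (suc i) ℕ.* S₂ i ≡ 0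
      out-of-range i n<i rewrite stirling1-vanishes (suc n) (suc i) (s≤s n<i) | ℕₚ.*-zeroʳ n = ≡.refl
    shifted-sum : ℕΣ.sumTo (suc n) (λ l → s₁ l ℕ.* S₂ l) ≡ suc r ℕ.* lah n (suc r) ℕ.+ lah n r
    shifted-sum = begin
      ℕΣ.sumTo (suc n) (λ l → s₁ l ℕ.* S₂ l)
        ≡⟨ ℕΣ.sumTo-suc n _ ⟩
      ℕΣ.sumTo n (λ l → s₁ (suc l) ℕ.* (suc r ℕ.* S₂ l ℕ.+ stirling2 (suc l) r))
        ≡⟨ ℕΣ.sumTo-cong n (λ l _ → ℕₚ.*-distribˡ-+ (s₁ (suc l)) _ _) ⟩
      ℕΣ.sumTo n (λ l → s₁ (suc l) ℕ.* (suc r ℕ.* S₂ l) ℕ.+ s₁ (suc l) ℕ.* stirling2 (suc l) r)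
        ≡⟨ ℕΣ.sumTo-distrib-+ n _ _ ⟩
      ℕΣ.sumTo n (λ l → s₁ (suc l) ℕ.* (suc r ℕ.* S₂ l)) ℕ.+ lah n r
        ≡⟨ ≡.cong (ℕ._+ lah n r) (ℕΣ.sumTo-cong n (λ l _ → x∙yz≈y∙xz (s₁ (suc l)) (suc r) (S₂ l))) ⟩
      ℕΣ.sumTo n (λ l → suc r ℕ.* (s₁ (suc l) ℕ.* S₂ l)) ℕ.+ lah n r
        ≡⟨ ≡.cong (ℕ._+ lah n r) (ℕΣ.*-distribˡ-sumTo n (suc r) _) ⟨
      suc r ℕ.* lah n (suc r) ℕ.+ lah n r ∎

  factorial-*-lah : ∀ n r → r ! ℕ.* lah n (suc r) ≡ n ! ℕ.* (suc n C suc r)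
  factorial-*-lah-pred : ∀ n r → r ! ℕ.* lah n r ≡ n ! ℕ.* (r ℕ.* (suc n C r))

  factorial-*-lah-pred n zero    = ≡.trans (≡.cong (1 ℕ.*_) (lah-zero n)) (≡.sym (ℕₚ.*-zeroʳ (n !)))
  factorial-*-lah-pred n (suc r) = begin
    (suc r ℕ.* r !) ℕ.* lah n (suc r)      ≡⟨ ℕₚ.*-assoc (suc r) (r !) _ ⟩
    suc r ℕ.* (r ! ℕ.* lah n (suc r))      ≡⟨ ≡.cong (suc r ℕ.*_) (factorial-*-lah n r) ⟩
    suc r ℕ.* (n ! ℕ.* (suc n C suc r))    ≡⟨ x∙yz≈y∙xz (suc r) (n !) _ ⟩
    n ! ℕ.* (suc r ℕ.* (suc n C suc r))    ∎
    where open ≡.≡-Reasoning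

  factorial-*-lah zero    zero    = ≡.refl
  factorial-*-lah zero    (suc r) = ≡.trans
    (≡.cong (λ s → suc r ! ℕ.* (1 ℕ.* s)) (stirling2-vanishes 1 (2 ℕ.+ r) (s≤s (s≤s z≤n))))
    (ℕₚ.*-zeroʳ (suc r !))
  factorial-*-lah (suc n) r = begin
    r ! ℕ.* lah (suc n) (suc r)
      ≡⟨ ≡.cong (r ! ℕ.*_) (lah-suc n r) ⟩
    r ! ℕ.* ((suc n ℕ.+ suc r) ℕ.* lah n (suc r) ℕ.+ lah n r)
      ≡⟨ solve 5 (λ f n r a b → f :* ((con 1 :+ n :+ (con 1 :+ r)) :* a :+ b) := (con 1 :+ n :+ (con 1 :+ r)) :* (f :* a) :+ f :* b)
                 ≡.refl (r !) n r (lah n (suc r)) (lah n r) ⟩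
    (suc n ℕ.+ suc r) ℕ.* (r ! ℕ.* lah n (suc r)) ℕ.+ r ! ℕ.* lah n r
      ≡⟨ ≡.cong₂ (λ a b → (suc n ℕ.+ suc r) ℕ.* a ℕ.+ b) (factorial-*-lah n r) (factorial-*-lah-pred n r) ⟩
    (suc n ℕ.+ suc r) ℕ.* (n ! ℕ.* B₁) ℕ.+ n ! ℕ.* (r ℕ.* B₀)
      ≡⟨ solve 5 (λ n r f b₁ b₀ → (con 1 :+ n :+ (con 1 :+ r)) :* (f :* b₁) :+ f :* (r :* b₀)
                                 := f :* ((con 1 :+ n) :* b₁ :+ ((con 1 :+ r) :* b₁ :+ r :* b₀)))
                 ≡.refl n r (n !) B₁ B₀ ⟩
    n ! ℕ.* (suc n ℕ.* B₁ ℕ.+ (suc r ℕ.* B₁ ℕ.+ r ℕ.* B₀))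
      ≡⟨ ≡.cong (λ b → n ! ℕ.* (suc n ℕ.* B₁ ℕ.+ b)) (binomial-step (suc n) r) ⟩
    n ! ℕ.* (suc n ℕ.* B₁ ℕ.+ suc n ℕ.* B₀)
      ≡⟨ solve 4 (λ n f b₁ b₀ → f :* ((con 1 :+ n) :* b₁ :+ (con 1 :+ n) :* b₀) := ((con 1 :+ n) :* f) :* (b₀ :+ b₁))
                 ≡.refl n (n !) B₁ B₀ ⟩
    suc n ! ℕ.* (B₀ ℕ.+ B₁)
      ≡⟨ ≡.cong (suc n ! ℕ.*_) (pascal (suc n) r) ⟨
    suc n ! ℕ.* (suc (suc n) C suc r) ∎
    where
    open ≡.≡-Reasoning
    B₁ B₀ : ℕ
    B₁ = suc n C suc r
    B₀ = suc n C r

  ∑-stirling1-stirling2 : ∀ n r K →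
    ℕΣ.sumTo n (λ l → stirling1 (suc n) (suc l) ℕ.* (r ! ℕ.* stirling2 (suc l) (suc r) ℕ.* K))
      ≡ n ! ℕ.* (K ℕ.* (suc n C suc r))
  ∑-stirling1-stirling2 n r K = begin
    ℕΣ.sumTo n (λ l → stirling1 (suc n) (suc l) ℕ.* (r ! ℕ.* stirling2 (suc l) (suc r) ℕ.* K))
      ≡⟨ ℕΣ.sumTo-cong n (λ l _ → solve 4 (λ s f S K → s :* (f :* S :* K) := K :* (f :* (s :* S))) ≡.refl
                                             (stirling1 (suc n) (suc l)) (r !) (stirling2 (suc l) (suc r)) K) ⟩
    ℕΣ.sumTo n (λ l → K ℕ.* (r ! ℕ.* (stirling1 (suc n) (suc l) ℕ.* stirling2 (suc l) (suc r))))
      ≡⟨ ℕΣ.*-distribˡ-sumTo n K _ ⟨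
    K ℕ.* ℕΣ.sumTo n (λ l → r ! ℕ.* (stirling1 (suc n) (suc l) ℕ.* stirling2 (suc l) (suc r)))
      ≡⟨ ≡.cong (K ℕ.*_) (ℕΣ.*-distribˡ-sumTo n (r !) _) ⟨
    K ℕ.* (r ! ℕ.* lah n (suc r))
      ≡⟨ ≡.cong (K ℕ.*_) (factorial-*-lah n r) ⟩
    K ℕ.* (n ! ℕ.* (suc n C suc r))
      ≡⟨ x∙yz≈y∙xz K (n !) (suc n C suc r) ⟩
    n ! ℕ.* (K ℕ.* (suc n C suc r)) ∎
    where open ≡.≡-Reasoning

open Lah using (∑-stirling1-stirling2)

-- Label sequences covering every ordinary block

occurs : ∀ {m k} → Fin m → Vec (Fin m) k → Bool
occurs c []       = false
occurs c (y ∷ ys) = does (y ≟ c) ∨ occurs c ys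

every : ∀ r → (Fin r → Bool) → Bool
every zero    p = true
every (suc r) p = p fz ∧ every r (p ∘ fs)

covers : ∀ r {k} → Vec (Fin (suc r)) k → Bool
covers r v = every r (λ j → occurs (fs j) v)

every-cong : ∀ r {p q : Fin r → Bool} → (∀ i → p i ≡ q i) → every r p ≡ every r q
every-cong zero    p≡q = ≡.refl
every-cong (suc r) p≡q = ≡.cong₂ _∧_ (p≡q fz) (every-cong r (p≡q ∘ fs))

every⇒ : ∀ r (p : Fin r → Bool) → every r p ≡ true → ∀ j → p j ≡ true
every⇒ (suc r) p holds j with p fz in p₀ | holds
every⇒ (suc r) p holds fz     | true | _     = p₀
every⇒ (suc r) p holds (fs j) | true | holds′ = every⇒ r (p ∘ fs) holds′ j

every-false : ∀ r (p : Fin r → Bool) j → p j ≡ false → every r p ≡ false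
every-false (suc r) p fz     pj≡false rewrite pj≡false = ≡.refl
every-false (suc r) p (fs j) pj≡false rewrite every-false r (p ∘ fs) j pj≡false = ∧-zeroʳ (p fz)

every-∨-≟ : ∀ r (p : Fin r → Bool) j → p j ≡ true → every r (λ i → p i ∨ does (j ≟ i)) ≡ every r p
every-∨-≟ r p j pj≡true = every-cong r pointwise
  where
  pointwise : ∀ i → (p i ∨ does (j ≟ i)) ≡ p i
  pointwise i with j ≟ i
  ... | yes ≡.refl = ≡.trans (∨-zeroʳ (p j)) (≡.sym pj≡true)
  ... | no  _      = ∨-identityʳ (p i)

every-punchIn : ∀ r (p : Fin (suc r) → Bool) j →
  every (suc r) (λ i → p i ∨ does (j ≟ i)) ≡ every r (p ∘ punchIn j)
every-punchIn r       p fz     = ≡.cong₂ _∧_ (∨-zeroʳ (p fz)) (every-cong r (λ i → ∨-identityʳ (p (fs i))))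
every-punchIn (suc r) p (fs j) = ≡.cong₂ _∧_ (∨-identityʳ (p fz)) (every-punchIn r (p ∘ fs) j)

punchIn≟punchIn : ∀ {m} (c : Fin (suc m)) (y a : Fin m) → does (punchIn c y ≟ punchIn c a) ≡ does (y ≟ a)
punchIn≟punchIn c y a with y ≟ a | punchIn c y ≟ punchIn c a
... | yes _      | yes _  = ≡.refl
... | no  _      | no  _  = ≡.refl
... | yes ≡.refl | no  ≢  = ⊥-elim (≢ ≡.refl)
... | no  ≢      | yes eq = ⊥-elim (≢ (Finₚ.punchIn-injective c y a eq))

occurs-∷ʳ : ∀ {m k} (c : Fin m) (v : Vec (Fin m) k) y → occurs c (v ∷ʳ y) ≡ occurs c v ∨ does (y ≟ c)
occurs-∷ʳ c []       y = ∨-identityʳ _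
occurs-∷ʳ c (x ∷ xs) y = ≡.trans (≡.cong (does (x ≟ c) ∨_) (occurs-∷ʳ c xs y)) (≡.sym (∨-assoc (does (x ≟ c)) _ _))

occurs-punchIn : ∀ {m k} (c : Fin (suc m)) a (u : Vec (Fin m) k) →
  occurs (punchIn c a) (Vec.map (punchIn c) u) ≡ occurs a u
occurs-punchIn c a []       = ≡.refl
occurs-punchIn c a (y ∷ ys) = ≡.cong₂ _∨_ (punchIn≟punchIn c y a) (occurs-punchIn c a ys)

occurs-punchIn-self : ∀ {m k} (c : Fin (suc m)) (u : Vec (Fin m) k) → occurs c (Vec.map (punchIn c) u) ≡ false
occurs-punchIn-self c []       = ≡.refl
occurs-punchIn-self c (y ∷ ys) =
  ≡.cong₂ _∨_ (dec-false (punchIn c y ≟ c) (Finₚ.punchInᵢ≢i c y)) (occurs-punchIn-self c ys)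

hitsOrdinary≡covers : ∀ r {k} (v : Vec (Fin (suc r)) k) → hitsOrdinary r v ≡ covers r v
hitsOrdinary≡covers r v = ≡.trans (all-tabulate (λ j → any (λ a → ⌊ a ≟ fs j ⌋) (Vec.toList v)) (λ i → i))
  (every-cong r (λ j → any-occurs (fs j) v))
  where
  any-occurs : ∀ {m k} (c : Fin m) (v : Vec (Fin m) k) → any (λ a → ⌊ a ≟ c ⌋) (Vec.toList v) ≡ occurs c v
  any-occurs c []       = ≡.refl
  any-occurs c (y ∷ ys) = ≡.cong₂ _∨_ (isYes≗does (y ≟ c)) (any-occurs c ys)
  all-tabulate : ∀ {A : Set} (p : A → Bool) {r} (g : Fin r → A) → all p (tabulate g) ≡ every r (p ∘ g)
  all-tabulate p {zero}  g = ≡.refl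
  all-tabulate p {suc r} g = ≡.cong (p (g fz) ∧_) (all-tabulate p (g ∘ fs))

covers-∷ʳ-fz : ∀ r {k} (v : Vec (Fin (suc r)) k) → covers r (v ∷ʳ fz) ≡ covers r v
covers-∷ʳ-fz r v = every-cong r (λ j → ≡.trans (occurs-∷ʳ (fs j) v fz) (∨-identityʳ _))

covers-∷ʳ-fs : ∀ r {k} (v : Vec (Fin (suc r)) k) j →
  covers r (v ∷ʳ fs j) ≡ every r (λ i → occurs (fs i) v ∨ does (j ≟ i))
covers-∷ʳ-fs r v j = every-cong r (λ i → occurs-∷ʳ (fs i) v (fs j))

module Covering {c ℓ} (R : CommutativeSemiring c ℓ) where

  open CommutativeSemiring R hiding (zero)
  open import Algebra.Definitions.RawSemiring rawSemiring using (_×_)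
  open import Algebra.Properties.Semiring.Sum semiring
    using (sum; sum-cong-≋; sum-remove; ∑-distrib-+; ∑-comm; sum-replicate; sum-replicate-zero)
  open import Algebra.Properties.Semiring.Mult semiring
    using (×-congˡ; ×-congʳ; ×-homo-0; ×-homo-1; ×-homo-+; ×-assocˡ; ×-comm-*)
  open import Relation.Binary.Reasoning.Setoid setoid
  open Sums R

  ∑vec : ∀ k m → (Vec (Fin m) k → Carrier) → Carrier
  ∑vec k m F = listSum F (allVecs k m)

  ∑vec-cong : ∀ k m {F G : Vec (Fin m) k → Carrier} → (∀ v → F v ≈ G v) → ∑vec k m F ≈ ∑vec k m G
  ∑vec-cong k m F≈G = listSum-cong F≈G (allVecs k m)

  ∑vec-∷ : ∀ k m (F : Vec (Fin m) (suc k) → Carrier) → ∑vec (suc k) m F ≈ ∑vec k m (λ v → sum (λ a → F (a ∷ v)))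
  ∑vec-∷ k m F = trans (listSum-concatMap F (λ v → map (_∷ v) (allFin m)) (allVecs k m))
    (∑vec-cong k m (λ v → reflexive (≡.trans (listSum-map F (_∷ v) (allFin m))
                                              (listSum-tabulate (F ∘ (_∷ v)) (λ i → i)))))

  ∑vec-∷ʳ : ∀ k m (F : Vec (Fin m) (suc k) → Carrier) → ∑vec (suc k) m F ≈ ∑vec k m (λ v → sum (λ a → F (v ∷ʳ a)))
  ∑vec-∷ʳ zero    m F = ∑vec-∷ zero m F
  ∑vec-∷ʳ (suc k) m F = begin
    ∑vec (suc (suc k)) m F                                     ≈⟨ ∑vec-∷ (suc k) m F ⟩
    ∑vec (suc k) m (λ w → sum (λ b → F (b ∷ w)))                ≈⟨ ∑vec-∷ʳ k m _ ⟩
    ∑vec k m (λ v → sum (λ a → sum (λ b → F (b ∷ (v ∷ʳ a)))))  ≈⟨ ∑vec-cong k m (λ v → ∑-comm (λ a b → F (b ∷ (v ∷ʳ a)))) ⟩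
    ∑vec k m (λ v → sum (λ b → sum (λ a → F ((b ∷ v) ∷ʳ a))))  ≈⟨ ∑vec-∷ k m _ ⟨
    ∑vec (suc k) m (λ w → sum (λ a → F (w ∷ʳ a)))              ∎

  guard : Bool → Carrier → Carrier
  guard b X = if b then X else 0#

  guard-congˡ : ∀ {b b′} X → b ≡ b′ → guard b X ≈ guard b′ X
  guard-congˡ X ≡.refl = refl

  guard-*ˡ : ∀ b a X → guard b (a * X) ≈ a * guard b X
  guard-*ˡ true  a X = refl
  guard-*ˡ false a X = sym (zeroʳ a)

  guard-as-* : ∀ b X → guard b X ≈ guard b 1# * X
  guard-as-* true  X = sym (*-identityˡ X)
  guard-as-* false X = sym (zeroˡ X)

  guard-+ : ∀ b X Y → guard b X + guard b Y ≈ guard b (X + Y)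
  guard-+ true  X Y = refl
  guard-+ false X Y = +-identityˡ 0#

  sum-guard : ∀ r b (f : Fin r → Carrier) → sum (λ i → guard b (f i)) ≈ guard b (sum f)
  sum-guard r true  f = refl
  sum-guard r false f = sum-replicate-zero r

  sum-avoiding : ∀ m (c : Fin (suc m)) (K : Fin (suc m) → Carrier) →
    sum (λ a → guard (not (does (a ≟ c))) (K a)) ≈ sum (K ∘ punchIn c)
  sum-avoiding m c K = begin
    sum t                      ≈⟨ sum-remove {i = c} t ⟩
    t c + sum (t ∘ punchIn c)  ≈⟨ +-cong (guard-congˡ (K c) t-c)
                                         (sum-cong-≋ (λ a → guard-congˡ (K (punchIn c a)) (t-punchIn a))) ⟩
    0# + sum (K ∘ punchIn c)   ≈⟨ +-identityˡ _ ⟩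
    sum (K ∘ punchIn c)        ∎
    where
    t : Fin (suc m) → Carrier
    t a = guard (not (does (a ≟ c))) (K a)
    t-c : not (does (c ≟ c)) ≡ false
    t-c = ≡.cong not (dec-true (c ≟ c) ≡.refl)
    t-punchIn : ∀ a → not (does (punchIn c a ≟ c)) ≡ true
    t-punchIn a = ≡.cong not (dec-false (punchIn c a ≟ c) (Finₚ.punchInᵢ≢i c a))

  ∑vec-avoiding : ∀ k m (c : Fin (suc m)) (H : Vec (Fin (suc m)) k → Carrier) →
    ∑vec k (suc m) (λ v → guard (not (occurs c v)) (H v)) ≈ ∑vec k m (H ∘ Vec.map (punchIn c))
  ∑vec-avoiding zero    m c H = refl
  ∑vec-avoiding (suc k) m c H = begin
    ∑vec (suc k) (suc m) (λ v → guard (not (occurs c v)) (H v))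
      ≈⟨ ∑vec-∷ k (suc m) _ ⟩
    ∑vec k (suc m) (λ v → sum (λ a → guard (not (does (a ≟ c) ∨ occurs c v)) (H (a ∷ v))))
      ≈⟨ ∑vec-cong k (suc m) head-avoiding ⟩
    ∑vec k (suc m) (λ v → guard (not (occurs c v)) (sum (λ a → H (punchIn c a ∷ v))))
      ≈⟨ ∑vec-avoiding k m c _ ⟩
    ∑vec k m (λ u → sum (λ a → H (punchIn c a ∷ Vec.map (punchIn c) u)))
      ≈⟨ ∑vec-∷ k m _ ⟨
    ∑vec (suc k) m (H ∘ Vec.map (punchIn c)) ∎
    where
    head-avoiding : ∀ v → sum (λ a → guard (not (does (a ≟ c) ∨ occurs c v)) (H (a ∷ v)))
                        ≈ guard (not (occurs c v)) (sum (λ a → H (punchIn c a ∷ v)))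
    head-avoiding v with occurs c v
    ... | true  = trans (sum-cong-≋ (λ a → guard-congˡ (H (a ∷ v)) (≡.cong not (∨-zeroʳ (does (a ≟ c))))))
                        (sum-replicate-zero (suc m))
    ... | false = trans (sum-cong-≋ (λ a → guard-congˡ (H (a ∷ v)) (≡.cong not (∨-identityʳ (does (a ≟ c))))))
                        (sum-avoiding m c (λ a → H (a ∷ v)))

  ∑covering : ∀ r k → (Vec (Fin (suc r)) k → Carrier) → Carrier
  ∑covering r k F = ∑vec k (suc r) (λ v → guard (covers r v) (F v))

  ∑covering-cong : ∀ r k {F G : Vec (Fin (suc r)) k → Carrier} →
    (∀ v → covers r v ≡ true → F v ≈ G v) → ∑covering r k F ≈ ∑covering r k G
  ∑covering-cong r k F≈G = ∑vec-cong k (suc r) pointwise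
    where
    pointwise : ∀ v → guard (covers r v) _ ≈ guard (covers r v) _
    pointwise v with covers r v in covered
    ... | true  = F≈G v covered
    ... | false = refl

  *-distribˡ-∑covering : ∀ r k a (F : Vec (Fin (suc r)) k → Carrier) →
    a * ∑covering r k F ≈ ∑covering r k (λ v → a * F v)
  *-distribˡ-∑covering r k a F = trans (*-distribˡ-listSum a _ (allVecs k (suc r)))
    (∑vec-cong k (suc r) (λ v → sym (guard-*ˡ (covers r v) a (F v))))

  ∑covering-× : ∀ r k n (F : Vec (Fin (suc r)) k → Carrier) → ∑covering r k (λ v → n × F v) ≈ n × ∑covering r k F
  ∑covering-× r k n F = trans (∑covering-cong r k (λ v _ → ×-as-* n (F v)))
    (trans (sym (*-distribˡ-∑covering r k (n × 1#) F)) (sym (×-as-* n _)))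

  guard-covers-∷ʳ : ∀ r {k} (v : Vec (Fin (suc r)) k) j X →
    guard (covers r (v ∷ʳ fs j)) X ≈ guard (covers r v) X + guard (not (occurs (fs j) v)) (guard (covers r (v ∷ʳ fs j)) X)
  guard-covers-∷ʳ r v j X with occurs (fs j) v in occ
  ... | true  = trans (guard-congˡ X (≡.trans (covers-∷ʳ-fs r v j) (every-∨-≟ r (λ i → occurs (fs i) v) j occ)))
                      (sym (+-identityʳ _))
  ... | false = trans (sym (+-identityˡ _))
                      (+-congʳ (guard-congˡ X (≡.sym (every-false r (λ i → occurs (fs i) v) j occ))))

  withNewBlock : ∀ {r k} → Fin r → Vec (Fin r) k → Vec (Fin (suc r)) (suc k)
  withNewBlock j u = Vec.map (punchIn (fs j)) u ∷ʳ fs j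

  covers-withNewBlock : ∀ r {k} (u : Vec (Fin (suc r)) k) j → covers (suc r) (withNewBlock j u) ≡ covers r u
  covers-withNewBlock r u j = ≡.trans (covers-∷ʳ-fs (suc r) (Vec.map (punchIn (fs j)) u) j)
    (≡.trans (every-punchIn r (λ i → occurs (fs i) (Vec.map (punchIn (fs j)) u)) j)
             (every-cong r (λ i → occurs-punchIn (fs j) (fs i) u)))

  sum-guard-covers-∷ʳ : ∀ r {k} (v : Vec (Fin (suc r)) k) (F : Vec (Fin (suc r)) (suc k) → Carrier) →
    sum (λ a → guard (covers r (v ∷ʳ a)) (F (v ∷ʳ a)))
      ≈ guard (covers r v) (sum (λ a → F (v ∷ʳ a)))
        + sum (λ j → guard (not (occurs (fs j) v)) (guard (covers r (v ∷ʳ fs j)) (F (v ∷ʳ fs j))))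
  sum-guard-covers-∷ʳ r v F = begin
    guard (covers r (v ∷ʳ fz)) (F (v ∷ʳ fz)) + sum (λ j → guard (covers r (v ∷ʳ fs j)) (F (v ∷ʳ fs j)))
      ≈⟨ +-cong (guard-congˡ (F (v ∷ʳ fz)) (covers-∷ʳ-fz r v))
                (sum-cong-≋ (λ j → guard-covers-∷ʳ r v j (F (v ∷ʳ fs j)))) ⟩
    guard (covers r v) (F (v ∷ʳ fz)) + sum (λ j → guard (covers r v) (F (v ∷ʳ fs j)) + fresh j)
      ≈⟨ +-congˡ (∑-distrib-+ _ fresh) ⟩
    guard (covers r v) (F (v ∷ʳ fz)) + (sum (λ j → guard (covers r v) (F (v ∷ʳ fs j))) + sum fresh)
      ≈⟨ +-assoc _ _ _ ⟨
    guard (covers r v) (F (v ∷ʳ fz)) + sum (λ j → guard (covers r v) (F (v ∷ʳ fs j))) + sum fresh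
      ≈⟨ +-congʳ (trans (+-congˡ (sum-guard r (covers r v) _)) (guard-+ (covers r v) _ _)) ⟩
    guard (covers r v) (sum (λ a → F (v ∷ʳ a))) + sum fresh ∎
    where
    fresh : Fin r → Carrier
    fresh j = guard (not (occurs (fs j) v)) (guard (covers r (v ∷ʳ fs j)) (F (v ∷ʳ fs j)))

  -- The last element either joins a block already met in v, or is the first element of ordinary block j + 1;
  -- then v avoids fs j, so it is the punchIn-relabelling of a sequence over the other labels.
  ∑covering-∷ʳ : ∀ r k (F : Vec (Fin (suc r)) (suc k) → Carrier) →
    ∑covering r (suc k) F ≈ ∑covering r k (λ v → sum (λ a → F (v ∷ʳ a)))
                          + sum (λ j → ∑vec k r (λ u → guard (covers r (withNewBlock j u)) (F (withNewBlock j u))))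
  ∑covering-∷ʳ r k F = begin
    ∑covering r (suc k) F
      ≈⟨ ∑vec-∷ʳ k (suc r) _ ⟩
    ∑vec k (suc r) (λ v → sum (λ a → guard (covers r (v ∷ʳ a)) (F (v ∷ʳ a))))
      ≈⟨ ∑vec-cong k (suc r) (λ v → sum-guard-covers-∷ʳ r v F) ⟩
    ∑vec k (suc r) (λ v → guard (covers r v) (sum (λ a → F (v ∷ʳ a))) + sum (fresh v))
      ≈⟨ listSum-distrib-+ _ _ (allVecs k (suc r)) ⟩
    ∑covering r k (λ v → sum (λ a → F (v ∷ʳ a))) + ∑vec k (suc r) (λ v → sum (fresh v))
      ≈⟨ +-congˡ (listSum-sum-comm r fresh (allVecs k (suc r))) ⟩
    ∑covering r k (λ v → sum (λ a → F (v ∷ʳ a))) + sum (λ j → ∑vec k (suc r) (λ v → fresh v j))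
      ≈⟨ +-congˡ (sum-cong-≋ (λ j → ∑vec-avoiding k r (fs j) (λ v → guard (covers r (v ∷ʳ fs j)) (F (v ∷ʳ fs j))))) ⟩
    _ ∎
    where
    fresh : Vec (Fin (suc r)) k → Fin r → Carrier
    fresh v j = guard (not (occurs (fs j) v)) (guard (covers r (v ∷ʳ fs j)) (F (v ∷ʳ fs j)))

  ∑covering-suc-∷ʳ : ∀ r k (F : Vec (Fin (suc (suc r))) (suc k) → Carrier) →
    ∑covering (suc r) (suc k) F ≈ ∑covering (suc r) k (λ v → sum (λ a → F (v ∷ʳ a)))
                                + ∑covering r k (λ u → sum (λ j → F (withNewBlock j u)))
  ∑covering-suc-∷ʳ r k F = trans (∑covering-∷ʳ (suc r) k F) (+-congˡ (begin
    sum (λ j → ∑vec k (suc r) (λ u → guard (covers (suc r) (withNewBlock j u)) (F (withNewBlock j u))))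
      ≈⟨ sum-cong-≋ (λ j → ∑vec-cong k (suc r) (λ u → guard-congˡ (F (withNewBlock j u)) (covers-withNewBlock r u j))) ⟩
    sum (λ j → ∑vec k (suc r) (λ u → guard (covers r u) (F (withNewBlock j u))))
      ≈⟨ listSum-sum-comm (suc r) (λ u j → guard (covers r u) (F (withNewBlock j u))) (allVecs k (suc r)) ⟨
    ∑vec k (suc r) (λ u → sum (λ j → guard (covers r u) (F (withNewBlock j u))))
      ≈⟨ ∑vec-cong k (suc r) (λ u → sum-guard (suc r) (covers r u) (λ j → F (withNewBlock j u))) ⟩
    ∑covering r k (λ u → sum (λ j → F (withNewBlock j u))) ∎))

  -- If appending an element to an existing block leaves G unchanged and the ways of opening a new block multiply
  -- it by c r, the covering sums follow the recurrence of the Stirling numbers of the second kind, with the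
  -- weight P r = c 0 * ⋯ * c (r - 1).
  module StirlingCount
    (G : ∀ r {k} → Vec (Fin (suc r)) k → Carrier) (c P : ℕ → Carrier)
    (G-∷ʳ : ∀ r {k} (v : Vec (Fin (suc r)) k) a → covers r v ≡ true → G r (v ∷ʳ a) ≈ G r v)
    (G-withNewBlock : ∀ r {k} (u : Vec (Fin (suc r)) k) → covers r u ≡ true →
                      sum (λ j → G (suc r) (withNewBlock j u)) ≈ c r * G r u)
    (G-[] : G 0 [] ≈ 1#) (P-zero : P 0 ≈ 1#) (P-suc : ∀ r → P (suc r) ≈ P r * c r)
    where

    sum-G-∷ʳ : ∀ r {k} (v : Vec (Fin (suc r)) k) → covers r v ≡ true → sum (λ a → G r (v ∷ʳ a)) ≈ suc r × G r v
    sum-G-∷ʳ r v covered = trans (sum-cong-≋ (λ a → G-∷ʳ r v a covered)) (sum-replicate (suc r))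

    ∑covering≈stirling2 : ∀ r k → ∑covering r k (G r) ≈ stirling2 (suc k) (suc r) × P r
    ∑covering≈stirling2 zero    zero    = trans (+-identityʳ _) (trans G-[] (sym (trans (+-identityʳ _) P-zero)))
    ∑covering≈stirling2 (suc r) zero    = trans (+-identityˡ 0#)
      (sym (trans (×-congˡ (stirling2-vanishes 1 (suc (suc r)) (s≤s (s≤s z≤n)))) (×-homo-0 (P (suc r)))))
    ∑covering≈stirling2 zero    (suc k) = begin
      ∑covering 0 (suc k) (G 0)
        ≈⟨ trans (∑covering-∷ʳ 0 k (G 0)) (+-identityʳ _) ⟩
      ∑covering 0 k (λ v → sum (λ a → G 0 (v ∷ʳ a)))
        ≈⟨ ∑covering-cong 0 k (λ v covered → trans (sum-G-∷ʳ 0 v covered) (×-homo-1 _)) ⟩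
      ∑covering 0 k (G 0)
        ≈⟨ ∑covering≈stirling2 0 k ⟩
      stirling2 (suc k) 1 × P 0
        ≈⟨ ×-congˡ (≡.trans (ℕₚ.+-identityʳ (S ℕ.+ 0)) (ℕₚ.+-identityʳ S)) ⟨
      stirling2 (suc (suc k)) 1 × P 0 ∎
      where
      S : ℕ
      S = stirling2 (suc k) 1
    ∑covering≈stirling2 (suc r) (suc k) = begin
      ∑covering (suc r) (suc k) (G (suc r))
        ≈⟨ ∑covering-suc-∷ʳ r k (G (suc r)) ⟩
      ∑covering (suc r) k (λ v → sum (λ a → G (suc r) (v ∷ʳ a)))
        + ∑covering r k (λ u → sum (λ j → G (suc r) (withNewBlock j u)))
        ≈⟨ +-cong (∑covering-cong (suc r) k (sum-G-∷ʳ (suc r))) (∑covering-cong r k (G-withNewBlock r)) ⟩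
      ∑covering (suc r) k (λ v → suc (suc r) × G (suc r) v) + ∑covering r k (λ u → c r * G r u)
        ≈⟨ +-cong (∑covering-× (suc r) k (suc (suc r)) (G (suc r))) (sym (*-distribˡ-∑covering r k (c r) (G r))) ⟩
      suc (suc r) × ∑covering (suc r) k (G (suc r)) + c r * ∑covering r k (G r)
        ≈⟨ +-cong (×-congʳ (suc (suc r)) (∑covering≈stirling2 (suc r) k)) (*-congˡ (∑covering≈stirling2 r k)) ⟩
      suc (suc r) × (S₂ × P (suc r)) + c r * (S₁ × P r)
        ≈⟨ +-cong (×-assocˡ _ (suc (suc r)) S₂)
                  (trans (×-comm-* S₁ (c r) (P r)) (×-congʳ S₁ (trans (*-comm (c r) (P r)) (sym (P-suc r))))) ⟩
      (suc (suc r) ℕ.* S₂) × P (suc r) + S₁ × P (suc r)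
        ≈⟨ ×-homo-+ (P (suc r)) (suc (suc r) ℕ.* S₂) S₁ ⟨
      stirling2 (suc (suc k)) (suc (suc r)) × P (suc r) ∎
      where
      S₂ S₁ : ℕ
      S₂ = stirling2 (suc k) (suc (suc r))
      S₁ = stirling2 (suc k) (suc r)

-- Left-to-right minima and the bar

ltrMinimaBelow : ℕ → List ℕ → ℕ
ltrMinimaBelow m []       = 0
ltrMinimaBelow m (b ∷ bs) = if b <ᵇ m then suc (ltrMinimaBelow b bs) else ltrMinimaBelow m bs

ltrMinima-∷ : ∀ a as → ltrMinima (a ∷ as) ≡ suc (ltrMinimaBelow a as)
ltrMinima-∷ a []       = ≡.refl
ltrMinima-∷ a (b ∷ bs) with b <ᵇ a
... | true  = ≡.cong suc (ltrMinima-∷ b bs)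
... | false = ltrMinima-∷ a bs

ltrMinimaBelow-0 : ∀ w → ltrMinimaBelow 0 w ≡ 0
ltrMinimaBelow-0 []      = ≡.refl
ltrMinimaBelow-0 (_ ∷ w) = ltrMinimaBelow-0 w

ltrMinimaBelow-bar : ∀ m p q → ltrMinimaBelow (suc m) (map suc p ++ 0 ∷ q) ≡ suc (ltrMinimaBelow m p)
ltrMinimaBelow-bar m []      q = ≡.cong suc (ltrMinimaBelow-0 q)
ltrMinimaBelow-bar m (c ∷ p) q with c <ᵇ m
... | true  = ≡.cong suc (ltrMinimaBelow-bar c p q)
... | false = ltrMinimaBelow-bar m p q

ltrMinima-bar : ∀ p q → ltrMinima (map suc p ++ 0 ∷ q) ≡ suc (ltrMinima p)
ltrMinima-bar []      q = ≡.trans (ltrMinima-∷ 0 q) (≡.cong suc (ltrMinimaBelow-0 q))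
ltrMinima-bar (a ∷ p) q = ≡.trans (ltrMinima-∷ (suc a) (map suc p ++ 0 ∷ q))
  (≡.cong suc (≡.trans (ltrMinimaBelow-bar a p q) (≡.sym (ltrMinima-∷ a p))))

firstOccurrences : ∀ {r k} → Vec (Fin (suc r)) k → Vector ℕ r
firstOccurrences blue j = firstIdx blue (fs j)

-- The bar is the letter 0, below every block letter: it is a left-to-right minimum (cancelled by the ∸ 1 of
-- wstat) and no letter after it is one.
wstat≡ltrMinima-prefix : ∀ {n k} r (red : Vec (Fin (suc r)) n) (blue : Vec (Fin (suc r)) k) b →
  wstat (r , red , blue , b) ≡ ltrMinima (take (toℕ b) (tabulate (firstOccurrences blue)))
wstat≡ltrMinima-prefix r red blue b = ≡.cong (ℕ._∸ 1) (begin
  ltrMinima (take (toℕ b) blocks ++ 0 ∷ drop (toℕ b) blocks)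
    ≡⟨ ≡.cong (λ w → ltrMinima (take (toℕ b) w ++ 0 ∷ drop (toℕ b) w)) blocks≡ ⟩
  ltrMinima (take (toℕ b) (map suc firsts) ++ 0 ∷ drop (toℕ b) (map suc firsts))
    ≡⟨ ≡.cong (λ w → ltrMinima (w ++ 0 ∷ drop (toℕ b) (map suc firsts))) (take-map (toℕ b) firsts) ⟩
  ltrMinima (map suc (take (toℕ b) firsts) ++ 0 ∷ drop (toℕ b) (map suc firsts))
    ≡⟨ ltrMinima-bar (take (toℕ b) firsts) _ ⟩
  suc (ltrMinima (take (toℕ b) firsts)) ∎)
  where
  open ≡.≡-Reasoning
  firsts blocks : List ℕ
  firsts = tabulate (firstOccurrences blue)
  blocks = map (λ j → suc (firstIdx blue (fs j))) (allFin r)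
  blocks≡ : blocks ≡ map suc firsts
  blocks≡ = ≡.trans (map-tabulate (λ i → i) _) (≡.sym (map-tabulate (firstOccurrences blue) suc))

≗-insertAt : ∀ {A : Set} {r} (j : Fin (suc r)) (f : Vector A (suc r)) (g : Vector A r) v →
  f j ≡ v → (∀ i → f (punchIn j i) ≡ g i) → ∀ i → f i ≡ insertAt g j v i
≗-insertAt fz             f g v fj≡v f∘punchIn≗g fz     = fj≡v
≗-insertAt fz             f g v fj≡v f∘punchIn≗g (fs i) = f∘punchIn≗g i
≗-insertAt {r = suc r} (fs j) f g v fj≡v f∘punchIn≗g fz     = f∘punchIn≗g fz
≗-insertAt {r = suc r} (fs j) f g v fj≡v f∘punchIn≗g (fs i) =
  ≗-insertAt j (f ∘ fs) (g ∘ fs) v fj≡v (f∘punchIn≗g ∘ fs) i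

<ᵇ-true : ∀ {a b} → a < b → (a <ᵇ b) ≡ true
<ᵇ-true {zero}  (s≤s _)   = ≡.refl
<ᵇ-true {suc a} (s≤s a<b) = <ᵇ-true a<b

<ᵇ-false : ∀ {a b} → b ≤ a → (a <ᵇ b) ≡ false
<ᵇ-false {a}     {zero}  _         = ≡.refl
<ᵇ-false {suc a} {suc b} (s≤s b≤a) = <ᵇ-false b≤a

module BarPolynomial {c ℓ} (R : CommutativeSemiring c ℓ) (x : CommutativeSemiring.Carrier R) where

  open CommutativeSemiring R hiding (zero)
  open import Algebra.Definitions.RawSemiring rawSemiring using (_^_; _×_)
  open import Algebra.Solver.Ring.NaturalCoefficients.Default R using (solve; _:+_; _:*_; _:=_; con)
  open import Relation.Binary.Reasoning.Setoid setoid
  open import Algebra.Properties.Semiring.Sum semiring using (sum⁺-syntax; sum-cong-≋; sum-replicate; ∑-distrib-+; *-distribˡ-sum)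
  open Sums R

  -- barPoly h is the generating polynomial Σ_b x ^ ltrMinima (first b letters of h) of the bar positions
  -- (sum-prefixes); barPolyBelow m h counts only the minima below m.
  barPolyBelow : ∀ {r} → ℕ → Vector ℕ r → Carrier
  barPolyBelow {zero}  m h = 1#
  barPolyBelow {suc r} m h = 1# + (if h fz <ᵇ m then x * barPolyBelow (h fz) (h ∘ fs) else barPolyBelow m (h ∘ fs))

  barPoly : ∀ {r} → Vector ℕ r → Carrier
  barPoly {zero}  h = 1#
  barPoly {suc r} h = 1# + x * barPolyBelow (h fz) (h ∘ fs)

  barPolyBelow-cong : ∀ {r} m {g h : Vector ℕ r} → (∀ i → g i ≡ h i) → barPolyBelow m g ≡ barPolyBelow m h
  barPolyBelow-cong {zero}  m g≗h = ≡.refl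
  barPolyBelow-cong {suc r} m {g} {h} g≗h rewrite g≗h fz with h fz <ᵇ m
  ... | true  = ≡.cong (λ p → 1# + x * p) (barPolyBelow-cong _ (g≗h ∘ fs))
  ... | false = ≡.cong (1# +_) (barPolyBelow-cong m (g≗h ∘ fs))

  barPoly-cong : ∀ {r} {g h : Vector ℕ r} → (∀ i → g i ≡ h i) → barPoly g ≡ barPoly h
  barPoly-cong {zero}  g≗h = ≡.refl
  barPoly-cong {suc r} g≗h rewrite g≗h fz = ≡.cong (λ p → 1# + x * p) (barPolyBelow-cong _ (g≗h ∘ fs))

  sum-prefixes-below : ∀ {r} m (h : Vector ℕ r) →
    ∑[ b ≤ r ] (x ^ ltrMinimaBelow m (take (toℕ b) (tabulate h))) ≈ barPolyBelow m h
  sum-prefixes-below {zero}  m h = +-identityʳ 1#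
  sum-prefixes-below {suc r} m h with h fz <ᵇ m
  ... | true  = +-congˡ (trans
    (sym (*-distribˡ-sum {suc r} x (λ b → x ^ ltrMinimaBelow (h fz) (take (toℕ b) (tabulate (h ∘ fs))))))
    (*-congˡ (sum-prefixes-below (h fz) (h ∘ fs))))
  ... | false = +-congˡ (sum-prefixes-below m (h ∘ fs))

  sum-prefixes : ∀ {r} (h : Vector ℕ r) →
    ∑[ b ≤ r ] (x ^ ltrMinima (take (toℕ b) (tabulate h))) ≈ barPoly h
  sum-prefixes {zero}  h = +-identityʳ 1#
  sum-prefixes {suc r} h = +-congˡ (begin
    ∑[ b ≤ r ] (x ^ ltrMinima (h fz ∷ take (toℕ b) (tabulate (h ∘ fs))))
      ≈⟨ sum-cong-≋ {suc r} (λ b → reflexive (≡.cong (x ^_) (ltrMinima-∷ (h fz) (take (toℕ b) (tabulate (h ∘ fs)))))) ⟩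
    ∑[ b ≤ r ] (x * x ^ ltrMinimaBelow (h fz) (take (toℕ b) (tabulate (h ∘ fs))))
      ≈⟨ *-distribˡ-sum {suc r} x (λ b → x ^ ltrMinimaBelow (h fz) (take (toℕ b) (tabulate (h ∘ fs)))) ⟨
    x * ∑[ b ≤ r ] (x ^ ltrMinimaBelow (h fz) (take (toℕ b) (tabulate (h ∘ fs))))
      ≈⟨ *-congˡ (sum-prefixes-below (h fz) (h ∘ fs)) ⟩
    x * barPolyBelow (h fz) (h ∘ fs) ∎)

  barPolyBelow-above : ∀ {r} (h : Vector ℕ r) M → (∀ i → h i < M) → barPolyBelow M h ≈ barPoly h
  barPolyBelow-above {zero}  h M h<M = refl
  barPolyBelow-above {suc r} h M h<M rewrite <ᵇ-true (h<M fz) = refl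

  barPolyBelow-insertAt : ∀ {r} (j : Fin (suc r)) (g : Vector ℕ r) M m → m ≤ M → (∀ i → g i < M) →
    barPolyBelow m (insertAt g j M) ≈ barPolyBelow m g + x ^ ltrMinimaBelow m (take (toℕ j) (tabulate g))
  barPolyBelow-insertAt fz g M m m≤M g<M rewrite <ᵇ-false m≤M = +-comm 1# _
  barPolyBelow-insertAt {suc r} (fs j) g M m m≤M g<M with g fz <ᵇ m
  ... | true  = trans (+-congˡ (*-congˡ (barPolyBelow-insertAt j (g ∘ fs) M (g fz) (ℕₚ.<⇒≤ (g<M fz)) (g<M ∘ fs))))
                  (solve 3 (λ x a b → con 1 :+ x :* (a :+ b) := (con 1 :+ x :* a) :+ x :* b) refl x _ _)
  ... | false = trans (+-congˡ (barPolyBelow-insertAt j (g ∘ fs) M m m≤M (g<M ∘ fs))) (sym (+-assoc 1# _ _))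

  barPoly-insertMax : ∀ {r} (h : Vector ℕ r) M → (∀ i → h i < M) →
    ∑[ j ≤ r ] barPoly (insertAt h j M) ≈ ((x + 1#) + r × 1#) * barPoly h
  barPoly-insertMax {zero}  h M h<M =
    solve 1 (λ x → (con 1 :+ x :* con 1) :+ con 0 := ((x :+ con 1) :+ con 0) :* con 1) refl x
  barPoly-insertMax {suc r} h M h<M = begin
    barPoly (insertAt h fz M) + ∑[ j ≤ r ] (1# + x * barPolyBelow h₀ (insertAt h′ j M))
      ≈⟨ +-cong (+-congˡ (*-congˡ (barPolyBelow-above h M h<M)))
                (sum-cong-≋ (λ j → +-congˡ {1#} (*-congˡ {x}
                  (barPolyBelow-insertAt j h′ M h₀ (ℕₚ.<⇒≤ (h<M fz)) (h<M ∘ fs))))) ⟩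
    (1# + x * (1# + x * U)) + ∑[ j ≤ r ] (1# + x * (U + e j))
      ≈⟨ +-congˡ (sum-cong-≋ (λ j → trans (+-congˡ (distribˡ x U (e j))) (sym (+-assoc 1# _ _)))) ⟩
    (1# + x * (1# + x * U)) + ∑[ j ≤ r ] ((1# + x * U) + x * e j)
      ≈⟨ +-congˡ (∑-distrib-+ (λ _ → 1# + x * U) (λ j → x * e j)) ⟩
    (1# + x * (1# + x * U)) + (∑[ j ≤ r ] (1# + x * U) + ∑[ j ≤ r ] (x * e j))
      ≈⟨ +-congˡ (+-cong (trans (sum-replicate (suc r)) (×-as-* (suc r) _)) (sym (*-distribˡ-sum x e))) ⟩
    (1# + x * (1# + x * U)) + (S * (1# + x * U) + x * ∑[ j ≤ r ] e j)
      ≈⟨ +-congˡ (+-congˡ (*-congˡ (sum-prefixes-below h₀ h′))) ⟩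
    (1# + x * (1# + x * U)) + (S * (1# + x * U) + x * U)
      ≈⟨ solve 3 (λ x U S → (con 1 :+ x :* (con 1 :+ x :* U)) :+ (S :* (con 1 :+ x :* U) :+ x :* U)
                           := ((x :+ con 1) :+ S) :* (con 1 :+ x :* U)) refl x U S ⟩
    ((x + 1#) + S) * (1# + x * U) ∎
    where
    h₀ : ℕ
    h₀ = h fz
    h′ : Vector ℕ r
    h′ = h ∘ fs
    U S : Carrier
    U = barPolyBelow h₀ h′
    S = suc r × 1#
    e : Fin (suc r) → Carrier
    e j = x ^ ltrMinimaBelow h₀ (take (toℕ j) (tabulate h′))

firstIdx-∷ʳ : ∀ {m k} (c : Fin m) (v : Vec (Fin m) k) y → occurs c v ≡ true → firstIdx (v ∷ʳ y) c ≡ firstIdx v c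
firstIdx-∷ʳ c (z ∷ zs) y occ with z ≟ c
... | yes _ = ≡.refl
... | no  _ = ≡.cong suc (firstIdx-∷ʳ c zs y occ)

firstIdx-∷ʳ-new : ∀ {m k} (c : Fin m) (v : Vec (Fin m) k) → occurs c v ≡ false → firstIdx (v ∷ʳ c) c ≡ k
firstIdx-∷ʳ-new c []       _ with c ≟ c
... | yes _  = ≡.refl
... | no c≢c = ⊥-elim (c≢c ≡.refl)
firstIdx-∷ʳ-new c (z ∷ zs) ¬occ with z ≟ c
... | no _ = ≡.cong suc (firstIdx-∷ʳ-new c zs ¬occ)

firstIdx-< : ∀ {m k} (c : Fin m) (v : Vec (Fin m) k) → occurs c v ≡ true → firstIdx v c < k
firstIdx-< c (z ∷ zs) occ with z ≟ c
... | yes _ = s≤s z≤n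
... | no  _ = s≤s (firstIdx-< c zs occ)

firstIdx-punchIn : ∀ {m k} (c : Fin (suc m)) a (u : Vec (Fin m) k) →
  firstIdx (Vec.map (punchIn c) u) (punchIn c a) ≡ firstIdx u a
firstIdx-punchIn c a []       = ≡.refl
firstIdx-punchIn c a (y ∷ ys)
  rewrite isYes≗does (punchIn c y ≟ punchIn c a) | punchIn≟punchIn c y a | isYes≗does (y ≟ a)
  with does (y ≟ a)
... | true  = ≡.refl
... | false = ≡.cong suc (firstIdx-punchIn c a ys)

-- Callan polynomials

-- The barred Callan sequences with r ordinary pairs: BC n k unfolds to concatMap (sequencesWith n k) (upTo (suc n)).
sequencesWith : ∀ n k r → List (Seq n k)
sequencesWith n k r = concatMap (λ red → concatMap (λ blue → map (λ b → (r , red , blue , b)) (allFin (suc r)))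
                                                   (filterᵇ (hitsOrdinary r) (allVecs k (suc r))))
                                (filterᵇ (hitsOrdinary r) (allVecs n (suc r)))

callanCoeff : ℕ → ℕ → ℕ → ℕ
callanCoeff l k r = r ! ℕ.* stirling2 (suc l) (suc r) ℕ.* stirling2 (suc k) (suc r)

callanCoeff-vanishes : ∀ {l} k {r} → l < r → callanCoeff l k r ≡ 0
callanCoeff-vanishes {l} k {r} l<r rewrite stirling2-vanishes (suc l) (suc r) (s≤s l<r) | ℕₚ.*-zeroʳ (r !) = ≡.refl

module Counting {c ℓ} (R : CommutativeSemiring c ℓ) (x : CommutativeSemiring.Carrier R) where

  open CommutativeSemiring R hiding (zero)
  open import Algebra.Definitions.RawSemiring rawSemiring using (_^_; _×_)
  open import Algebra.Properties.Semiring.Sum semiring using (sum⁺-syntax; sum-cong-≋; sum-replicate)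
  open import Algebra.Properties.Semiring.Mult semiring using (×-congˡ; ×-congʳ; ×1-homo-*; ×-assocˡ; ×-homo-0)
  open import Relation.Binary.Reasoning.Setoid setoid
  open Sums R
  open Covering R
  open BarPolynomial R x
  open Eval R using (rising; callan)

  ∑covering-red : ∀ r k → ∑covering r k (λ _ → 1#) ≈ stirling2 (suc k) (suc r) × ((r !) × 1#)
  ∑covering-red = StirlingCount.∑covering≈stirling2 (λ _ _ → 1#) (λ r → suc r × 1#) (λ r → (r !) × 1#)
    (λ _ _ _ _ → refl) (λ r _ _ → trans (sum-replicate (suc r)) (sym (*-identityʳ _)))
    refl (+-identityʳ 1#) factorial-suc
    where
    factorial-suc : ∀ r → (suc r !) × 1# ≈ ((r !) × 1#) * (suc r × 1#)
    factorial-suc r = trans (×-congˡ (ℕₚ.*-comm (suc r) (r !))) (×1-homo-* (r !) (suc r))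

  blueWeight : ∀ r {k} → Vec (Fin (suc r)) k → Carrier
  blueWeight r blue = barPoly (firstOccurrences blue)

  blueWeight-∷ʳ : ∀ r {k} (v : Vec (Fin (suc r)) k) a → covers r v ≡ true → blueWeight r (v ∷ʳ a) ≈ blueWeight r v
  blueWeight-∷ʳ r v a covered =
    reflexive (barPoly-cong (λ j → firstIdx-∷ʳ (fs j) v a (every⇒ r _ covered j)))

  firstOccurrences-withNewBlock : ∀ r {k} (u : Vec (Fin (suc r)) k) → covers r u ≡ true → ∀ j →
    ∀ i → firstOccurrences (withNewBlock j u) i ≡ insertAt (firstOccurrences u) j k i
  firstOccurrences-withNewBlock r u covered j = ≗-insertAt j _ _ _
    (firstIdx-∷ʳ-new (fs j) (Vec.map (punchIn (fs j)) u) (occurs-punchIn-self (fs j) u))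
    (λ i → ≡.trans (firstIdx-∷ʳ (punchIn (fs j) (fs i)) (Vec.map (punchIn (fs j)) u) (fs j)
                                (≡.trans (occurs-punchIn (fs j) (fs i) u) (every⇒ r _ covered i)))
                   (firstIdx-punchIn (fs j) (fs i) u))

  blueWeight-withNewBlock : ∀ r {k} (u : Vec (Fin (suc r)) k) → covers r u ≡ true →
    ∑[ j ≤ r ] blueWeight (suc r) (withNewBlock j u) ≈ ((x + 1#) + r × 1#) * blueWeight r u
  blueWeight-withNewBlock r {k} u covered = trans
    (sum-cong-≋ (λ j → reflexive (barPoly-cong (firstOccurrences-withNewBlock r u covered j))))
    (barPoly-insertMax (firstOccurrences u) k (λ i → firstIdx-< (fs i) u (every⇒ r _ covered i)))

  ∑covering-blue : ∀ r k → ∑covering r k (blueWeight r) ≈ stirling2 (suc k) (suc r) × rising (x + 1#) r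
  ∑covering-blue = StirlingCount.∑covering≈stirling2 blueWeight (λ r → (x + 1#) + r × 1#) (rising (x + 1#))
    blueWeight-∷ʳ blueWeight-withNewBlock refl refl (λ _ → refl)

  ∑covering-const : ∀ r k Y → ∑covering r k (λ _ → Y) ≈ ∑covering r k (λ _ → 1#) * Y
  ∑covering-const r k Y = trans (∑vec-cong k (suc r) (λ v → guard-as-* (covers r v) Y))
    (sym (*-distribʳ-listSum Y _ (allVecs k (suc r))))

  listSum-covering : ∀ r k (F : Vec (Fin (suc r)) k → Carrier) →
    listSum F (filterᵇ (hitsOrdinary r) (allVecs k (suc r))) ≈ ∑covering r k F
  listSum-covering r k F = trans (listSum-filterᵇ F (hitsOrdinary r) (allVecs k (suc r)))
    (∑vec-cong k (suc r) (λ v → guard-congˡ (F v) (hitsOrdinary≡covers r v)))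

  ∑-bars : ∀ {n k} r (red : Vec (Fin (suc r)) n) (blue : Vec (Fin (suc r)) k) →
    ∑[ b ≤ r ] (x ^ wstat (r , red , blue , b)) ≈ blueWeight r blue
  ∑-bars r red blue = trans (sum-cong-≋ (λ b → reflexive (≡.cong (x ^_) (wstat≡ltrMinima-prefix r red blue b))))
    (sum-prefixes (firstOccurrences blue))

  ∑-sequencesWith : ∀ n k r → listSum (λ α → x ^ wstat α) (sequencesWith n k r)
    ≈ callanCoeff n k r × rising (x + 1#) r
  ∑-sequencesWith n k r = begin
    listSum f (concatMap (λ red → concatMap (barred red) blues) reds)
      ≈⟨ listSum-concatMap f _ reds ⟩
    listSum (λ red → listSum f (concatMap (barred red) blues)) reds
      ≈⟨ listSum-cong (λ red → trans (listSum-concatMap f (barred red) blues)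
           (listSum-cong (λ blue → trans (reflexive (listSum-barred red blue)) (∑-bars r red blue)) blues)) reds ⟩
    listSum (λ _ → listSum (blueWeight r) blues) reds
      ≈⟨ trans (listSum-covering r n _) (∑covering-const r n _) ⟩
    ∑covering r n (λ _ → 1#) * listSum (blueWeight r) blues
      ≈⟨ *-cong (∑covering-red r n) (trans (listSum-covering r k _) (∑covering-blue r k)) ⟩
    (S₂ⁿ × ((r !) × 1#)) * (S₂ᵏ × rising (x + 1#) r)
      ≈⟨ *-congʳ (×-assocˡ 1# S₂ⁿ (r !)) ⟩
    ((S₂ⁿ ℕ.* r !) × 1#) * (S₂ᵏ × rising (x + 1#) r)
      ≈⟨ ×-as-* (S₂ⁿ ℕ.* r !) _ ⟨
    (S₂ⁿ ℕ.* r !) × (S₂ᵏ × rising (x + 1#) r)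
      ≈⟨ ×-assocˡ _ (S₂ⁿ ℕ.* r !) S₂ᵏ ⟩
    (S₂ⁿ ℕ.* r ! ℕ.* S₂ᵏ) × rising (x + 1#) r
      ≈⟨ ×-congˡ (≡.cong (ℕ._* S₂ᵏ) (ℕₚ.*-comm S₂ⁿ (r !))) ⟩
    callanCoeff n k r × rising (x + 1#) r ∎
    where
    f : Seq n k → Carrier
    f α = x ^ wstat α
    S₂ⁿ S₂ᵏ : ℕ
    S₂ⁿ = stirling2 (suc n) (suc r)
    S₂ᵏ = stirling2 (suc k) (suc r)
    reds : List (Vec (Fin (suc r)) n)
    reds = filterᵇ (hitsOrdinary r) (allVecs n (suc r))
    blues : List (Vec (Fin (suc r)) k)
    blues = filterᵇ (hitsOrdinary r) (allVecs k (suc r))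
    barred : Vec (Fin (suc r)) n → Vec (Fin (suc r)) k → List (Seq n k)
    barred red blue = map (λ b → (r , red , blue , b)) (allFin (suc r))
    listSum-barred : ∀ red blue → listSum f (barred red blue) ≡ ∑[ b ≤ r ] f (r , red , blue , b)
    listSum-barred red blue =
      ≡.trans (listSum-map f _ (allFin (suc r))) (listSum-tabulate (λ b → f (r , red , blue , b)) (λ b → b))

  callan-closedForm : ∀ l k → callan x l k ≈ sumTo l (λ r → callanCoeff l k r × rising (x + 1#) r)
  callan-closedForm zero    k       = sym (trans (×-congˡ (≡.trans (ℕₚ.*-identityˡ _) (stirling2-1 k))) (+-identityʳ 1#))
  callan-closedForm (suc l) zero    = sym (begin
    sumTo (suc l) (λ r → callanCoeff (suc l) 0 r × rising (x + 1#) r)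
      ≈⟨ sumTo-truncate 0 (suc l) _ z≤n
           (λ { (suc r) _ _ → trans (×-congˡ (single-blue-block r)) (×-homo-0 (rising (x + 1#) (suc r))) }) ⟩
    callanCoeff (suc l) 0 0 × 1#
      ≈⟨ ×-congˡ (≡.trans (ℕₚ.*-identityʳ _) (≡.trans (ℕₚ.*-identityˡ _) (stirling2-1 (suc l)))) ⟩
    1 × 1#
      ≈⟨ +-identityʳ 1# ⟩
    1# ∎)
    where
    single-blue-block : ∀ r → callanCoeff (suc l) 0 (suc r) ≡ 0
    single-blue-block r = ≡.trans (≡.cong (suc r ! ℕ.* stirling2 (2 ℕ.+ l) (2 ℕ.+ r) ℕ.*_)
                                          (stirling2-vanishes 1 (2 ℕ.+ r) (s≤s (s≤s z≤n))))
                                  (ℕₚ.*-zeroʳ (suc r ! ℕ.* stirling2 (2 ℕ.+ l) (2 ℕ.+ r)))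
  callan-closedForm (suc l) (suc k) = begin
    listSum (λ α → x ^ wstat α) (concatMap (sequencesWith (suc l) (suc k)) (upTo (2 ℕ.+ l)))
      ≈⟨ listSum-concatMap _ (sequencesWith (suc l) (suc k)) (upTo (2 ℕ.+ l)) ⟩
    listSum (λ r → listSum (λ α → x ^ wstat α) (sequencesWith (suc l) (suc k) r)) (upTo (2 ℕ.+ l))
      ≈⟨ listSum-cong (∑-sequencesWith (suc l) (suc k)) (upTo (2 ℕ.+ l)) ⟩
    listSum (λ r → callanCoeff (suc l) (suc k) r × rising (x + 1#) r) (upTo (2 ℕ.+ l))
      ≈⟨ listSum-applyUpTo (suc l) (λ r → r) _ ⟩
    sumTo (suc l) (λ r → callanCoeff (suc l) (suc k) r × rising (x + 1#) r) ∎

  ∑stirling1×callan : ∀ n k →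
    sumTo n (λ l → stirling1 (suc n) (suc l) × callan x l k)
      ≈ sumTo n (λ r → ℕΣ.sumTo n (λ l → stirling1 (suc n) (suc l) ℕ.* callanCoeff l k r) × rising (x + 1#) r)
  ∑stirling1×callan n k = begin
    sumTo n (λ l → s l × callan x l k)
      ≈⟨ sumTo-cong n (λ l l≤n → ×-congʳ (s l) (callan-upTo l≤n)) ⟩
    sumTo n (λ l → s l × sumTo n (λ r → callanCoeff l k r × ρ r))
      ≈⟨ sumTo-cong n (λ l _ → trans (×-distrib-sumTo n (s l) _) (sumTo-cong n (λ r _ → ×-assocˡ (ρ r) (s l) _))) ⟩
    sumTo n (λ l → sumTo n (λ r → (s l ℕ.* callanCoeff l k r) × ρ r))
      ≈⟨ sumTo-comm n n _ ⟩
    sumTo n (λ r → sumTo n (λ l → (s l ℕ.* callanCoeff l k r) × ρ r))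
      ≈⟨ sumTo-cong n (λ r _ → sumTo-× n _ (ρ r)) ⟨
    sumTo n (λ r → ℕΣ.sumTo n (λ l → s l ℕ.* callanCoeff l k r) × ρ r) ∎
    where
    s : ℕ → ℕ
    s l = stirling1 (suc n) (suc l)
    ρ : ℕ → Carrier
    ρ = rising (x + 1#)
    callan-upTo : ∀ {l} → l ≤ n → callan x l k ≈ sumTo n (λ r → callanCoeff l k r × ρ r)
    callan-upTo {l} l≤n = trans (callan-closedForm l k) (sym (sumTo-truncate l n _ l≤n
      (λ r l<r _ → trans (×-congˡ (callanCoeff-vanishes k l<r)) (×-homo-0 (ρ r)))))

  stirling1-transform-callan : ∀ n k →
    sumTo n (λ l → stirling1 (suc n) (suc l) × callan x l k)
      ≈ (n !) × sumTo (n ⊓ k) (λ j → (stirling2 (suc k) (suc j) ℕ.* (suc n C suc j)) × rising (x + 1#) j)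
  stirling1-transform-callan n k = begin
    sumTo n (λ l → stirling1 (suc n) (suc l) × callan x l k)
      ≈⟨ ∑stirling1×callan n k ⟩
    sumTo n (λ r → ℕΣ.sumTo n (λ l → stirling1 (suc n) (suc l) ℕ.* callanCoeff l k r) × ρ r)
      ≈⟨ sumTo-cong n (λ r _ → trans (×-congˡ (∑-stirling1-stirling2 n r (stirling2 (suc k) (suc r))))
                                     (sym (×-assocˡ (ρ r) (n !) (a r)))) ⟩
    sumTo n (λ r → (n !) × (a r × ρ r))
      ≈⟨ ×-distrib-sumTo n (n !) _ ⟨
    (n !) × sumTo n (λ r → a r × ρ r)
      ≈⟨ ×-congʳ (n !) (sumTo-truncate (n ⊓ k) n _ (ℕₚ.m⊓n≤m n k) beyond-k) ⟩
    (n !) × sumTo (n ⊓ k) (λ r → a r × ρ r) ∎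
    where
    ρ : ℕ → Carrier
    ρ = rising (x + 1#)
    a : ℕ → ℕ
    a r = stirling2 (suc k) (suc r) ℕ.* (suc n C suc r)
    beyond-k : ∀ r → n ⊓ k < r → r ≤ n → a r × ρ r ≈ 0#
    beyond-k r n⊓k<r r≤n = trans (×-congˡ (≡.cong (ℕ._* (suc n C suc r)) (stirling2-vanishes (suc k) (suc r) (s≤s k<r))))
                                 (×-homo-0 (ρ r))
      where
      k<r : k < r
      k<r = ℕₚ.≰⇒> (λ r≤k → ℕₚ.<⇒≱ n⊓k<r (ℕₚ.⊓-glb r≤n r≤k))

open import Data.Nat using (_*_)
open import Algebra.Definitions.RawSemiring using (_×_)

mainTheorem12 : ∀ {c ℓ} (R : CommutativeSemiring c ℓ) (x : CommutativeSemiring.Carrier R) (n k : ℕ) →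
    CommutativeSemiring._≈_ R
      (Eval.sumTo R n (λ l → _×_ (CommutativeSemiring.rawSemiring R) (stirling1 (suc n) (suc l)) (Eval.callan R x l k)))
      (_×_ (CommutativeSemiring.rawSemiring R) (n !)
        (Eval.sumTo R (n ⊓ k) (λ j → _×_ (CommutativeSemiring.rawSemiring R) (stirling2 (suc k) (suc j) * (suc n C suc j))
          (Eval.rising R (CommutativeSemiring._+_ R x (CommutativeSemiring.1# R)) j))))
mainTheorem12 R x = Counting.stirling1-transform-callan R x
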